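{- Let $\mathcal{G}$ be a maximal ancestral graph (MAG) with vertex set $\mathcal{V}$ and let $W\subseteq\mathcal{V}$. Then $W\notin\mathcal{S}(\mathcal{G})$ if and only if there exist two vertices $a,b\in W$ and a set $C\subseteq\mathcal{V}$ with $a,b\notin C$ and $W\subseteq C\cup\{a,b\}$ such that $a$ and $b$ are m-separated by $C$ in $\mathcal{G}$.
   Context: An acyclic directed mixed graph (ADMG) $\mathcal{G}$ on a finite vertex set $\mathcal{V}$ has directed ($a\to b$) and bidirected ($a\leftrightarrow b$) edges and no directed cycle. $\mathrm{pa}_{\mathcal{G}}(v)=\{w:w\to v\}$, $\mathrm{sib}_{\mathcal{G}}(v)=\{w:w\leftrightarrow v\}$, $\mathrm{an}_{\mathcal{G}}(v)$ ($\mathrm{de}_{\mathcal{G}}(v)$) is $v$ together with vertices having a directed path to (from) $v$, $\mathrm{dis}_{\mathcal{G}}(v)$ is $v$ together with vertices joined to $v$ by a path of bidirected edges; for sets take unions. $\mathcal{G}_W$ is the induced subgraph on $W$, $\mathrm{dis}_W(\cdot)$ the district in $\mathcal{G}_W$. A path is a sequence of distinct vertices, consecutive ones joined by an edge; a non-endpoint $w$ is a collider if both path edges at $w$ have an arrowhead at $w$, else a noncollider. For $a,b\notin C$, a path between $a,b$ is m-connecting given $C$ if all noncolliders are outside $C$ and all colliders are in $\mathrm{an}_{\mathcal{G}}(C)$; $a$ and $b$ are m-separated by $C$ if no such path exists. Vertices are adjacent if joined by an edge. $\mathcal{G}$ is maximal if each nonadjacent pair is m-separated by some set, ancestral if $\mathrm{sib}_{\mathcal{G}}(v)\cap\mathrm{an}_{\mathcal{G}}(v)=\emptyset$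 for all $v$; a MAG is a maximal ancestral ADMG. $\mathrm{barren}_{\mathcal{G}}(W)=\{w\in W:\mathrm{de}_{\mathcal{G}}(w)\cap W=\{w\}\}$. A head is $H\subseteq\mathcal{V}$ with $\mathrm{barren}_{\mathcal{G}}(H)=H$ and $H$ contained in one district of $\mathcal{G}_{\mathrm{an}_{\mathcal{G}}(H)}$; $\mathrm{tail}(H)=(\mathrm{dis}_{\mathrm{an}(H)}(H)\setminus H)\cup\mathrm{pa}_{\mathcal{G}}(\mathrm{dis}_{\mathrm{an}(H)}(H))$. $\mathcal{S}(\mathcal{G})=\{H\cup A:H \text{ a head},\ A\subseteq\mathrm{tail}(H)\}$. -}

module Defs where

open import Data.Nat using (ℕ; zero; suc)
open import Data.Fin using (Fin; zero; suc; inject₁; fromℕ; toℕ)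
open import Data.Fin.Subset using (Subset; _∈_; _∉_; _∪_)
open import Data.Bool using (Bool; true; false)
open import Data.Product using (Σ; ∃; _×_; _,_)
open import Data.Sum using (_⊎_)
open import Data.Unit using (⊤)
open import Data.Empty using (⊥)
open import Relation.Binary.PropositionalEquality using (_≡_; _≢_)
open import Relation.Nullary using (¬_)
open import Function.Definitions using (Injective)

-- Acyclic directed mixed graphs on the vertex set Fin n.
-- dir u v ≡ true  means  u → v ;  bi u v ≡ true  means  u ↔ v.

-- Directed-path reachability:  Anc a b  means  a ∈ an(b)  (equivalently b ∈ de(a)).
-- (a is its own ancestor.)
data Reach {n : ℕ} (dir : Fin n → Fin n → Bool) : Fin n → Fin n → Set where
  here : ∀ {a} → Reach dir a a
  step : ∀ {a c b} → dir a c ≡ true → Reach dir c b → Reach dir a b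

record ADMG (n : ℕ) : Set where
  field
    dir       : Fin n → Fin n → Bool
    bi        : Fin n → Fin n → Bool
    bi-sym    : ∀ u v → bi u v ≡ bi v u
    bi-irrefl : ∀ u → bi u u ≡ false
    acyclic   : ∀ u v → dir u v ≡ true → ¬ Reach dir v u

module _ {n : ℕ} (G : ADMG n) where
  open ADMG G

  Anc : Fin n → Fin n → Set
  Anc = Reach dir

  InAn : Subset n → Fin n → Set
  InAn S w = ∃ λ v → v ∈ S × Anc w v

  Adjacent : Fin n → Fin n → Set
  Adjacent a b = dir a b ≡ true ⊎ dir b a ≡ true ⊎ bi a b ≡ true

  data Step : Set where
    fwd : Step
    bwd : Step
    bid : Step

  EdgeOK : Fin n → Step → Fin n → Set
  EdgeOK u fwd v = dir u v ≡ true
  EdgeOK u bwd v = dir v u ≡ true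
  EdgeOK u bid v = bi u v ≡ true

  HeadAtTarget : Step → Set
  HeadAtTarget fwd = ⊤
  HeadAtTarget bwd = ⊥
  HeadAtTarget bid = ⊤

  HeadAtSource : Step → Set
  HeadAtSource fwd = ⊥
  HeadAtSource bwd = ⊤
  HeadAtSource bid = ⊤

  record Path (a b : Fin n) : Set where
    field
      k        : ℕ
      vs       : Fin (suc k) → Fin n
      es       : Fin k → Step
      distinct : Injective _≡_ _≡_ vs
      edges    : ∀ i → EdgeOK (vs (inject₁ i)) (es i) (vs (suc i))
      start    : vs zero ≡ a
      end      : vs (fromℕ k) ≡ b

  -- The inner vertex vs (i+1) lies between edge i and edge j (toℕ j ≡ suc (toℕ i));
  -- it is a collider iff both edges have an arrowhead at it.
  MConnecting : {a b : Fin n} → Subset n → Path a b → Set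
  MConnecting C p =
    ∀ (i j : Fin k) → toℕ j ≡ suc (toℕ i) →
      (HeadAtTarget (es i) × HeadAtSource (es j) → InAn C (vs (suc i)))
    × (¬ (HeadAtTarget (es i) × HeadAtSource (es j)) → vs (suc i) ∉ C)
    where open Path p

  -- a and b are m-separated by C  (a, b ∉ C is imposed where used)
  MSeparated : Fin n → Fin n → Subset n → Set
  MSeparated a b C = ¬ (Σ (Path a b) λ p → MConnecting C p)

  Maximal : Set
  Maximal = ∀ a b → a ≢ b → ¬ Adjacent a b →
              ∃ λ C → a ∉ C × b ∉ C × MSeparated a b C

  Ancestral : Set
  Ancestral = ∀ v w → bi w v ≡ true → ¬ Anc w v

  IsMAG : Set
  IsMAG = Maximal × Ancestral

  -- Districts in an induced subgraph G_P: bidirected path with all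
  -- vertices satisfying P.
  data BiConnIn (P : Fin n → Set) : Fin n → Fin n → Set where
    here : ∀ {a} → P a → BiConnIn P a a
    step : ∀ {a c b} → P a → bi a c ≡ true → BiConnIn P c b → BiConnIn P a b

  -- barren(H) = H
  Barren : Subset n → Set
  Barren H = ∀ h w → h ∈ H → w ∈ H → Anc h w → h ≡ w

  Head : Subset n → Set
  Head H = Barren H × (∀ h h′ → h ∈ H → h′ ∈ H → BiConnIn (InAn H) h h′)

  InDis : Subset n → Fin n → Set
  InDis H v = ∃ λ h → h ∈ H × BiConnIn (InAn H) h v

  InTail : Subset n → Fin n → Set
  InTail H v = (InDis H v × v ∉ H) ⊎ (∃ λ w → InDis H w × dir v w ≡ true)

  InS : Subset n → Set
  InS W = ∃ λ H → ∃ λ A → Head H × (∀ v → v ∈ A → InTail H v) × W ≡ H ∪ A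

-- W ∈ S(G) exactly when any two distinct a, b ∈ W are collider-connected through
-- an(W): adjacent, or joined by a walk a *→ v ↔ ⋯ ↔ w ←* b whose inner vertices
-- lie in an(W). If all pairs are, the barren part H of W is a head and every other
-- vertex of W lies in, or is a parent of, the district of H in an(H); conversely a
-- head H with W = H ∪ A joins any two vertices of W through that district.
--
-- A collider walk whose inner vertices lie in an(C ∪ {a, b}) yields an m-connecting
-- path given C: a collider outside an(C) is bypassed by a directed path to a or b,
-- and loops are cut, which acyclicity keeps m-connecting. Conversely, for
-- C = an(W) ∖ {a, b} an m-connecting path is a collider path through an(W). So W ∉ S(G)
-- iff some pair of W is not collider-connected iff some pair is m-separated by some
-- C ⊇ W ∖ {a, b}.

module Submission where

open import Defs
open import Data.Bool using (true)
import Data.Bool.Properties as Bool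
open import Data.Empty using (⊥-elim)
open import Data.Fin using (Fin; zero; suc; toℕ; inject₁)
open import Data.Fin.Properties using (_≟_; any?; all?; suc-injective)
open import Data.Fin.Subset using (Subset; _∈_; _∉_; _∪_; _⊆_; _⊂_; _⊃_; ⁅_⁆)
open import Data.Fin.Subset.Induction using (⊂-wellFounded; ⊃-wellFounded)
open import Data.Fin.Subset.Properties
  using (_∈?_; _⊂?_; x∈⁅x⁆; x∈⁅y⁆⇒x≡y; x∈p∪q⁻; x∈p∪q⁺; ⊆-antisym)
open import Data.List using (List; []; _∷_)
open import Data.List.Membership.Propositional using () renaming (_∈_ to _∈ₗ_; _∉_ to _∉ₗ_)
import Data.List.Relation.Unary.Any as Any
open import Data.Nat using (ℕ)
import Data.Nat as ℕ
open import Data.Product using (Σ; ∃; ∃₂; _×_; _,_; proj₁; proj₂)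
open import Data.Sum using (_⊎_; inj₁; inj₂; [_,_])
import Data.Sum as Sum
open import Data.Unit using (⊤; tt)
open import Data.Vec using (tabulate)
open import Data.Vec.Properties using (lookup∘tabulate; []=⇒lookup; lookup⇒[]=)
open import Function using (_∘_; id)
open import Function.Bundles using (_⇔_; mk⇔)
open import Induction.WellFounded using (Acc; acc)
open import Level using (Level; 0ℓ)
open import Relation.Binary.Construct.Closure.ReflexiveTransitive using (Star; ε; _◅_)
open import Relation.Binary.Core using (Rel)
import Relation.Binary.Definitions as Binary
open import Relation.Binary.PropositionalEquality using (_≡_; _≢_; refl; sym; trans; cong; subst)
open import Relation.Nullary using (¬_; Dec; yes; no; does)
open import Relation.Nullary.Decidable using (map′; _×-dec_; _⊎-dec_; _→-dec_; ¬?; decidable-stable)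
open import Relation.Unary using (Pred; Decidable)

private
  variable
    ℓ : Level
    n : ℕ

subset : {P : Pred (Fin n) ℓ} → Decidable P → Subset n
subset P? = tabulate (λ x → does (P? x))

module _ {P : Pred (Fin n) ℓ} (P? : Decidable P) {x : Fin n} where

  ∈-subset⁺ : P x → x ∈ subset P?
  ∈-subset⁺ px = lookup⇒[]= x (subset P?) (trans (lookup∘tabulate _ x) (accept (P? x)))
    where
    accept : (d : Dec (P x)) → does d ≡ true
    accept (yes _) = refl
    accept (no ¬px) = ⊥-elim (¬px px)

  ∈-subset⁻ : x ∈ subset P? → P x
  ∈-subset⁻ x∈ = witness (P? x) (trans (sym (lookup∘tabulate _ x)) ([]=⇒lookup x∈))
    where
    witness : (d : Dec (P x)) → does d ≡ true → P x
    witness (yes px) _ = px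

-- Saturating {y} under one-step predecessors strictly enlarges the set until it
-- is backward closed, and _⊃_ is well founded on subsets.
module _ {E : Rel (Fin n) ℓ} (E? : Binary.Decidable E) where

  private
    StepInto : Subset n → Pred (Fin n) ℓ
    StepInto S x = x ∈ S ⊎ ∃ λ z → E x z × z ∈ S

    stepInto? : ∀ S → Decidable (StepInto S)
    stepInto? S x = x ∈? S ⊎-dec any? (λ z → E? x z ×-dec z ∈? S)

    predecessors : Subset n → Subset n
    predecessors S = subset (stepInto? S)

    BackwardClosed : Subset n → Set ℓ
    BackwardClosed R = ∀ {x z} → E x z → z ∈ R → x ∈ R

    ReachSet : Fin n → Subset n → Set ℓ
    ReachSet y R = y ∈ R × BackwardClosed R × (∀ {x} → x ∈ R → Star E x y)

    saturate : ∀ y R → Acc _⊃_ R → y ∈ R → (∀ {x} → x ∈ R → Star E x y) → ∃ (ReachSet y)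
    saturate y R (acc rec) y∈R sound with R ⊂? predecessors R
    ... | yes R⊂R′ = saturate y (predecessors R) (rec R⊂R′) (proj₁ R⊂R′ y∈R) sound′
      where
      sound′ : ∀ {x} → x ∈ predecessors R → Star E x y
      sound′ x∈ with ∈-subset⁻ (stepInto? R) x∈
      ... | inj₁ x∈R = sound x∈R
      ... | inj₂ (z , xz , z∈R) = xz ◅ sound z∈R
    ... | no R⊄R′ = R , y∈R , closed , sound
      where
      closed : BackwardClosed R
      closed {x} xz z∈R with x ∈? R
      ... | yes x∈R = x∈R
      ... | no x∉R = ⊥-elim (R⊄R′ (grow , x , ∈-subset⁺ (stepInto? R) (inj₂ (_ , xz , z∈R)) , x∉R))
        where
        grow : R ⊆ predecessors R
        grow v∈R = ∈-subset⁺ (stepInto? R) (inj₁ v∈R)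

    star-closed : ∀ {R x y} → BackwardClosed R → Star E x y → y ∈ R → x ∈ R
    star-closed closed ε y∈R = y∈R
    star-closed closed (xz ◅ zy) y∈R = closed xz (star-closed closed zy y∈R)

    singleton-sound : ∀ {x y} → x ∈ ⁅ y ⁆ → Star E x y
    singleton-sound {y = y} x∈ rewrite x∈⁅y⁆⇒x≡y y x∈ = ε

  star? : Binary.Decidable (Star E)
  star? x y =
    let R , y∈R , closed , sound = saturate y ⁅ y ⁆ (⊃-wellFounded _) (x∈⁅x⁆ y) singleton-sound
    in map′ sound (λ xy → star-closed closed xy y∈R) (x ∈? R)

module _ {n : ℕ} (G : ADMG n) where
  open ADMG G

  anc-trans : ∀ {x y z} → Anc G x y → Anc G y z → Anc G x z
  anc-trans here yz = yz
  anc-trans (step e xy) yz = step e (anc-trans xy yz)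

  anc-antisym : ∀ {x y} → Anc G x y → Anc G y x → x ≡ y
  anc-antisym here _ = refl
  anc-antisym (step e xy) yx = ⊥-elim (acyclic _ _ e (anc-trans xy yx))

  inAn-anc : ∀ {S x y} → Anc G x y → InAn G S y → InAn G S x
  inAn-anc xy (v , v∈S , yv) = v , v∈S , anc-trans xy yv

  inAn-⊆ : ∀ {S T x} → (∀ {v} → v ∈ S → InAn G T v) → InAn G S x → InAn G T x
  inAn-⊆ S⊆anT (v , v∈S , xv) = inAn-anc xv (S⊆anT v∈S)

  bi-flip : ∀ {x y} → bi x y ≡ true → bi y x ≡ true
  bi-flip {x} {y} e = trans (bi-sym y x) e

  module _ {P : Pred (Fin n) 0ℓ} where

    biConn-start : ∀ {x y} → BiConnIn G P x y → P x
    biConn-start (here px) = px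
    biConn-start (step px _ _) = px

    biConn-end : ∀ {x y} → BiConnIn G P x y → P y
    biConn-end (here py) = py
    biConn-end (step _ _ r) = biConn-end r

    biConn-trans : ∀ {x y z} → BiConnIn G P x y → BiConnIn G P y z → BiConnIn G P x z
    biConn-trans (here _) yz = yz
    biConn-trans (step px e xy) yz = step px e (biConn-trans xy yz)

    biConn-snoc : ∀ {x y z} → BiConnIn G P x y → bi y z ≡ true → P z → BiConnIn G P x z
    biConn-snoc xy e pz = biConn-trans xy (step (biConn-end xy) e (here pz))

    biConn-sym : ∀ {x y} → BiConnIn G P x y → BiConnIn G P y x
    biConn-sym (here px) = here px
    biConn-sym (step px e r) = biConn-snoc (biConn-sym r) (bi-flip e) px

  biConn-mono : ∀ {P Q : Pred (Fin n) 0ℓ} → (∀ {x} → P x → Q x) →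
                ∀ {x y} → BiConnIn G P x y → BiConnIn G Q x y
  biConn-mono P⊆Q (here px) = here (P⊆Q px)
  biConn-mono P⊆Q (step px e r) = step (P⊆Q px) e (biConn-mono P⊆Q r)

  anc? : ∀ x y → Dec (Anc G x y)
  anc? x y = map′ fromStar toStar (star? (λ u v → dir u v Bool.≟ true) x y)
    where
    fromStar : ∀ {x} → Star (λ u v → dir u v ≡ true) x y → Anc G x y
    fromStar ε = here
    fromStar (e ◅ r) = step e (fromStar r)
    toStar : ∀ {x} → Anc G x y → Star (λ u v → dir u v ≡ true) x y
    toStar here = ε
    toStar (step e r) = e ◅ toStar r

  inAn? : ∀ S → Decidable (InAn G S)
  inAn? S x = any? (λ v → v ∈? S ×-dec anc? x v)

  biConnIn? : ∀ {P : Pred (Fin n) 0ℓ} → Decidable P → ∀ x y → Dec (BiConnIn G P x y)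
  biConnIn? {P} P? x y = map′ fromStar toStar (star? (λ u v → P? u ×-dec bi u v Bool.≟ true) x y ×-dec P? y)
    where
    Edge : Rel (Fin n) 0ℓ
    Edge u v = P u × bi u v ≡ true
    fromStar : ∀ {x} → Star Edge x y × P y → BiConnIn G P x y
    fromStar (ε , py) = here py
    fromStar ((px , e) ◅ r , py) = step px e (fromStar (r , py))
    toStar : ∀ {x} → BiConnIn G P x y → Star Edge x y × P y
    toStar (here py) = ε , py
    toStar (step px e r) = (px , e) ◅ proj₁ (toStar r) , proj₂ (toStar r)

  IntoEdge : Fin n → Fin n → Set
  IntoEdge a v = dir a v ≡ true ⊎ bi a v ≡ true

  edge-adjacent : ∀ {x y} s → EdgeOK G x s y → Adjacent G x y
  edge-adjacent fwd x→y = inj₁ x→y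
  edge-adjacent bwd y→x = inj₂ (inj₁ y→x)
  edge-adjacent bid x↔y = inj₂ (inj₂ x↔y)

  intoEdge⇒adjacent : ∀ {a b} → IntoEdge a b → Adjacent G a b
  intoEdge⇒adjacent (inj₁ a→b) = inj₁ a→b
  intoEdge⇒adjacent (inj₂ a↔b) = inj₂ (inj₂ a↔b)

  into-target : ∀ {x y} s → HeadAtTarget G s → EdgeOK G x s y → IntoEdge x y
  into-target fwd _ x→y = inj₁ x→y
  into-target bid _ x↔y = inj₂ x↔y

  into-source : ∀ {x y} s → HeadAtSource G s → EdgeOK G x s y → IntoEdge y x
  into-source bwd _ y→x = inj₁ y→x
  into-source bid _ x↔y = inj₂ (bi-flip x↔y)

  both-heads : ∀ {x y} s → HeadAtTarget G s → HeadAtSource G s → EdgeOK G x s y → bi x y ≡ true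
  both-heads bid _ _ x↔y = x↔y

  intoEdge? : ∀ a v → Dec (IntoEdge a v)
  intoEdge? a v = dir a v Bool.≟ true ⊎-dec bi a v Bool.≟ true

  ColliderWalk : Pred (Fin n) 0ℓ → Fin n → Fin n → Set
  ColliderWalk P a b = ∃₂ λ v w → IntoEdge a v × BiConnIn G P v w × IntoEdge b w

  ColliderConnected : Pred (Fin n) 0ℓ → Fin n → Fin n → Set
  ColliderConnected P a b = Adjacent G a b ⊎ ColliderWalk P a b

  colliderConnected? : ∀ {P : Pred (Fin n) 0ℓ} → Decidable P → ∀ a b → Dec (ColliderConnected P a b)
  colliderConnected? P? a b =
    (dir a b Bool.≟ true ⊎-dec dir b a Bool.≟ true ⊎-dec bi a b Bool.≟ true) ⊎-dec
    any? (λ v → any? (λ w → intoEdge? a v ×-dec biConnIn? P? v w ×-dec intoEdge? b w))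

module MWalks {n : ℕ} (G : ADMG n) (C : Subset n) where
  open ADMG G
  open import Data.List.Membership.DecPropositional (_≟_ {n}) using () renaming (_∈?_ to _∈ₗ?_)

  headAtTarget? : ∀ m → Dec (HeadAtTarget G m)
  headAtTarget? fwd = yes tt
  headAtTarget? bwd = no λ ()
  headAtTarget? bid = yes tt

  headAtSource? : ∀ s → Dec (HeadAtSource G s)
  headAtSource? fwd = no λ ()
  headAtSource? bwd = yes tt
  headAtSource? bid = yes tt

  Collider : Step G → Step G → Set
  Collider m s = HeadAtTarget G m × HeadAtSource G s

  Role : Step G → Step G → Fin n → Set
  Role m s x = (Collider m s → InAn G C x) × (¬ Collider m s → x ∉ C)

  collider-role : ∀ {m s x} → Collider m s → InAn G C x → Role m s x
  collider-role c x∈anC = (λ _ → x∈anC) , (λ ¬c → ⊥-elim (¬c c))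

  noncollider-role : ∀ {m s x} → ¬ Collider m s → x ∉ C → Role m s x
  noncollider-role ¬c x∉C = (λ c → ⊥-elim (¬c c)) , (λ _ → x∉C)

  bwd-role : ∀ {s x} → x ∉ C → Role bwd s x
  bwd-role = noncollider-role λ { (() , _) }

  fwd-role : ∀ {m x} → x ∉ C → Role m fwd x
  fwd-role = noncollider-role λ { (_ , ()) }

  -- The index m is the step entering the first vertex; every vertex but the last
  -- satisfies the m-connection condition given C.
  data MWalk : Step G → Fin n → Fin n → Set where
    []   : ∀ {m b} → MWalk m b b
    step : ∀ {m x y b} (s : Step G) → EdgeOK G x s y → Role m s x → MWalk s y b → MWalk m x b

  -- Nothing enters the first vertex a; indexing by bwd (no arrowhead at its
  -- target) makes the condition at a just a ∉ C.
  MConnectingWalk : Fin n → Fin n → Set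
  MConnectingWalk = MWalk bwd

  start-inAn⊎anc : ∀ {m y b} → HeadAtTarget G m → MWalk m y b → InAn G C y ⊎ Anc G y b
  start-inAn⊎anc _ [] = inj₂ here
  start-inAn⊎anc hm (step fwd e _ w) with start-inAn⊎anc tt w
  ... | inj₁ z∈anC = inj₁ (inAn-anc G (step e here) z∈anC)
  ... | inj₂ z≤b = inj₂ (step e z≤b)
  start-inAn⊎anc hm (step bwd _ r _) = inj₁ (proj₁ r (hm , tt))
  start-inAn⊎anc hm (step bid _ r _) = inj₁ (proj₁ r (hm , tt))

  collider-in : ∀ {m s x} → Role m s x → x ∈ C → Collider m s
  collider-in {m} {s} r x∈C with headAtTarget? m ×-dec headAtSource? s
  ... | yes c = c
  ... | no ¬c = ⊥-elim (proj₂ r ¬c x∈C)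

  vertices : ∀ {m x b} → MWalk m x b → List (Fin n)
  vertices {x = x} [] = x ∷ []
  vertices {x = x} (step _ _ _ w) = x ∷ vertices w

  end∈vertices : ∀ {m x b} (w : MWalk m x b) → b ∈ₗ vertices w
  end∈vertices [] = Any.here refl
  end∈vertices (step _ _ _ w) = Any.there (end∈vertices w)

  Simple : ∀ {m x b} → MWalk m x b → Set
  Simple [] = ⊤
  Simple {x = x} (step _ _ _ w) = x ∉ₗ vertices w × Simple w

  suffix-from : ∀ {m x y b} (w : MWalk m y b) → x ∈ₗ vertices w → Simple w →
                MWalk m y x × ∃ λ m′ → Σ (MWalk m′ x b) Simple
  suffix-from {m} [] (Any.here refl) _ = [] , m , [] , tt
  suffix-from (step s e r w) (Any.here refl) sw = [] , _ , step s e r w , sw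
  suffix-from (step s e r w) (Any.there x∈w) (_ , sw) with suffix-from w x∈w sw
  ... | loop , rest = step s e r loop , rest

  -- If x is left by x → y, the loop is entered at y with an arrowhead; by
  -- acyclicity it cannot run down a directed path back to x, so it meets an(C).
  loop-start-inAn : ∀ {m x y} s → Role m s x → EdgeOK G x s y → MWalk s y x →
                    HeadAtTarget G m → InAn G C x
  loop-start-inAn fwd _ e loop _ with start-inAn⊎anc tt loop
  ... | inj₁ y∈anC = inAn-anc G (step e here) y∈anC
  ... | inj₂ y≤x = ⊥-elim (acyclic _ _ e y≤x)
  loop-start-inAn bwd r _ _ hm = proj₁ r (hm , tt)
  loop-start-inAn bid r _ _ hm = proj₁ r (hm , tt)

  -- Cutting a loop at x: x keeps the entering step of its first visit and the
  -- leaving step of its last one.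
  cut-loop-role : ∀ {m s m′ s′ x y} → Role m s x → EdgeOK G x s y → MWalk s y x → Role m′ s′ x →
                  Role m s′ x
  cut-loop-role {m} {s} {s′ = s′} {x} r e loop r′ =
    (λ (hm , _) → loop-start-inAn s r e loop hm) , noncollider
    where
    noncollider : ¬ Collider m s′ → x ∉ C
    noncollider ¬c with headAtTarget? m
    ... | yes hm = proj₂ r′ (λ (_ , hs′) → ¬c (hm , hs′))
    ... | no ¬hm = proj₂ r (¬hm ∘ proj₁)

  simplify : ∀ {m x b} → MWalk m x b → Σ (MWalk m x b) Simple
  simplify [] = [] , tt
  simplify {x = x} (step s e r w) with simplify w
  ... | w′ , sw′ with x ∈ₗ? vertices w′
  ... | no x∉w′ = step s e r w′ , x∉w′ , sw′
  ... | yes x∈w′ with suffix-from w′ x∈w′ sw′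
  ... | _ , _ , [] , _ = [] , tt
  ... | loop , _ , step s′ e′ r′ w″ , sw″ = step s′ e′ (cut-loop-role r e loop r′) w″ , sw″

  Entered : ∀ {x b} → Step G → Path G x b → Set
  Entered m p = ∀ j → toℕ j ≡ 0 → Role m (es j) (vs zero)
    where open Path p

  trivial-path : ∀ b → Path G b b
  trivial-path b = record
    { k = 0 ; vs = λ _ → b ; es = λ () ; distinct = λ { {zero} {zero} _ → refl }
    ; edges = λ () ; start = refl ; end = refl }

  cons-path : ∀ {x y b} s → EdgeOK G x s y → (p : Path G y b) → (∀ i → Path.vs p i ≢ x) → Path G x b
  cons-path {x} s e p fresh = record
    { k = ℕ.suc k ; vs = vs′ ; es = es′ ; distinct = distinct′ ; edges = edges′ ; start = refl ; end = end }
    where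
    open Path p
    vs′ : Fin (ℕ.suc (ℕ.suc k)) → Fin n
    vs′ zero = x
    vs′ (suc i) = vs i
    es′ : Fin (ℕ.suc k) → Step G
    es′ zero = s
    es′ (suc i) = es i
    distinct′ : ∀ {i j} → vs′ i ≡ vs′ j → i ≡ j
    distinct′ {zero} {zero} _ = refl
    distinct′ {zero} {suc j} eq = ⊥-elim (fresh j (sym eq))
    distinct′ {suc i} {zero} eq = ⊥-elim (fresh i eq)
    distinct′ {suc i} {suc j} eq = cong suc (distinct eq)
    edges′ : ∀ i → EdgeOK G (vs′ (inject₁ i)) (es′ i) (vs′ (suc i))
    edges′ zero rewrite start = e
    edges′ (suc i) = edges i

  simple-walk⇒path : ∀ {m x b} (w : MWalk m x b) → Simple w →
           Σ (Path G x b) λ p → MConnecting G C p × Entered m p × (∀ i → Path.vs p i ∈ₗ vertices w)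
  simple-walk⇒path {x = x} [] _ = trivial-path x , (λ ()) , (λ ()) , λ _ → Any.here refl
  simple-walk⇒path {m} {x} (step s e r w) (x∉w , sw) with simple-walk⇒path w sw
  ... | p , mc , entered , ⊆w = cons-path s e p fresh , mc′ , entered′ , ⊆step
    where
    fresh : ∀ i → Path.vs p i ≢ x
    fresh i refl = x∉w (⊆w i)
    mc′ : MConnecting G C (cons-path s e p fresh)
    mc′ zero (suc j) eq = entered j (cong ℕ.pred eq)
    mc′ (suc i) (suc j) eq = mc i j (cong ℕ.pred eq)
    entered′ : Entered m (cons-path s e p fresh)
    entered′ zero _ = r
    ⊆step : ∀ i → Path.vs (cons-path s e p fresh) i ∈ₗ vertices (step s e r w)
    ⊆step zero = Any.here refl
    ⊆step (suc i) = Any.there (⊆w i)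

  SimpleWalkOn : ∀ {x b} → Step G → Path G x b → Set
  SimpleWalkOn {x} {b} m p =
    Σ (MWalk m x b) λ w → Simple w × (∀ {v} → v ∈ₗ vertices w → ∃ λ i → Path.vs p i ≡ v)

  path⇒simple-walk : ∀ {m x b} (p : Path G x b) → MConnecting G C p → Entered m p → SimpleWalkOn m p
  path⇒simple-walk p = by-length (Path.k p) p refl
    where
    by-length : ∀ {m x b} k (p : Path G x b) → Path.k p ≡ k → MConnecting G C p → Entered m p →
                SimpleWalkOn m p
    by-length ℕ.zero record { k = ℕ.zero ; start = refl ; end = refl } refl _ _ =
      [] , tt , λ { (Any.here refl) → zero , refl }
    by-length (ℕ.suc k) record { k = ℕ.suc k ; vs = vs ; es = es ; distinct = distinct ; edges = edges
                               ; start = refl ; end = end } refl mc entered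
      with by-length k (record { k = k ; vs = vs ∘ suc ; es = es ∘ suc ; distinct = suc-injective ∘ distinct
                               ; edges = edges ∘ suc ; start = refl ; end = end }) refl
                     (λ i j eq → mc (suc i) (suc j) (cong ℕ.suc eq))
                     (λ j eq → mc zero (suc j) (cong ℕ.suc eq))
    ... | w , sw , ⊆vs = step (es zero) (edges zero) (entered zero refl) w , (fresh , sw) , ⊆vs′
      where
      fresh : vs zero ∉ₗ vertices w
      fresh v∈w with ⊆vs v∈w
      ... | i , eq with distinct eq
      ... | ()
      ⊆vs′ : ∀ {v} → v ∈ₗ vertices (step (es zero) (edges zero) (entered zero refl) w) →
             ∃ λ i → vs i ≡ v
      ⊆vs′ (Any.here refl) = zero , refl
      ⊆vs′ (Any.there v∈w) with ⊆vs v∈w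
      ... | i , eq = suc i , eq

  walk⇒m-connecting-path : ∀ {a b} → MConnectingWalk a b → Σ (Path G a b) (MConnecting G C)
  walk⇒m-connecting-path w =
    let w′ , simple = simplify w
        p , mc , _ = simple-walk⇒path w′ simple
    in p , mc

  m-connecting-path⇒walk : ∀ {a b} → a ∉ C → Σ (Path G a b) (MConnecting G C) →
                           Σ (MConnectingWalk a b) Simple
  m-connecting-path⇒walk a∉C (p , mc) =
    let w , simple , _ = path⇒simple-walk p mc (λ _ _ → bwd-role (subst (_∉ C) (sym (Path.start p)) a∉C))
    in w , simple

module Unblocking {n : ℕ} (G : ADMG n) (C : Subset n) {a b : Fin n} (a∉C : a ∉ C) where
  open MWalks G C

  ∉anC⇒∉C : ∀ {v} → ¬ InAn G C v → v ∉ C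
  ∉anC⇒∉C v∉anC v∈C = v∉anC (_ , v∈C , here)

  descend : ∀ {m v} → Anc G v b → ¬ InAn G C v → MWalk m v b
  descend here _ = []
  descend (step e w≤b) v∉anC =
    step fwd e (fwd-role (∉anC⇒∉C v∉anC)) (descend w≤b (v∉anC ∘ inAn-anc G (step e here)))

  ascend : ∀ {y} → Anc G y a → ¬ InAn G C y → MConnectingWalk y b → MConnectingWalk a b
  ascend here _ w = w
  ascend (step {c = z} e z≤a) y∉anC w =
    ascend z≤a z∉anC (step bwd e (bwd-role {s = bwd} (∉anC⇒∉C z∉anC)) w)
    where
    z∉anC : ¬ InAn G C z
    z∉anC = y∉anC ∘ inAn-anc G (step e here)

  Restart : Set
  Restart = ∃ λ y → Anc G y a × ¬ InAn G C y × MConnectingWalk y b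

  Unblocked : Step G → Fin n → Set
  Unblocked m v = MWalk m v b ⊎ Restart

  module _ {P : Pred (Fin n) 0ℓ} (cover : ∀ {v} → P v → InAn G C v ⊎ Anc G v a ⊎ Anc G v b) where

    -- A collider outside an(C) lies above a or b. Above b, finish along a directed
    -- path down to b; above a, restart the walk there, later to be prefixed by a
    -- directed path a ← ⋯ ← v. The last restart along the walk wins.
    pass-collider : ∀ {m s v c} → Collider m s → EdgeOK G v s c → P v → Unblocked s c → Unblocked m v
    pass-collider {s = s} {v} {c} col e pv rest with inAn? G C v | cover pv
    ... | yes v∈anC | _ = Sum.map₁ (step _ e (collider-role col v∈anC)) rest
    ... | no v∉anC | inj₁ v∈anC = ⊥-elim (v∉anC v∈anC)
    ... | no v∉anC | inj₂ (inj₂ v≤b) = inj₁ (descend v≤b v∉anC)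
    ... | no v∉anC | inj₂ (inj₁ v≤a) = inj₂ ([ restart , id ] rest)
      where
      restart : MWalk s c b → Restart
      restart w = v , v≤a , v∉anC , step s e (bwd-role (∉anC⇒∉C v∉anC)) w

    along-chain : ∀ {m v w} → HeadAtTarget G m → BiConnIn G P v w → IntoEdge G b w → Unblocked m v
    along-chain hm (here pw) (inj₁ b→w) = pass-collider {s = bwd} (hm , tt) b→w pw (inj₁ [])
    along-chain hm (here pw) (inj₂ b↔w) = pass-collider {s = bid} (hm , tt) (bi-flip G b↔w) pw (inj₁ [])
    along-chain hm (step pv v↔c cw) bw = pass-collider {s = bid} (hm , tt) v↔c pv (along-chain tt cw bw)

    from-start : ∀ {v} s → EdgeOK G a s v → Unblocked s v → MConnectingWalk a b
    from-start s e (inj₁ w) = step s e (bwd-role a∉C) w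
    from-start s e (inj₂ (_ , y≤a , y∉anC , w)) = ascend y≤a y∉anC w

    collider-connected⇒walk : ColliderConnected G P a b → MConnectingWalk a b
    collider-connected⇒walk (inj₁ (inj₁ a→b)) = step fwd a→b (bwd-role a∉C) []
    collider-connected⇒walk (inj₁ (inj₂ (inj₁ b→a))) = step bwd b→a (bwd-role {s = bwd} a∉C) []
    collider-connected⇒walk (inj₁ (inj₂ (inj₂ a↔b))) = step bid a↔b (bwd-role {s = bid} a∉C) []
    collider-connected⇒walk (inj₂ (_ , _ , inj₁ a→v , vw , bw)) = from-start fwd a→v (along-chain tt vw bw)
    collider-connected⇒walk (inj₂ (_ , _ , inj₂ a↔v , vw , bw)) = from-start bid a↔v (along-chain tt vw bw)

-- For C = an(W) ∖ {a, b}, every inner vertex of an m-connecting path lies in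
-- an(W), hence in C, hence is a collider.
module Separation {n : ℕ} (G : ADMG n) (W C : Subset n) {a b : Fin n} (a∈W : a ∈ W) (b∈W : b ∈ W)
                  (C⊆anW : ∀ {v} → v ∈ C → InAn G W v)
                  (anW⊆C : ∀ {v} → InAn G W v → v ≢ a → v ≢ b → v ∈ C) where
  open ADMG G
  open MWalks G C

  start-inAnW : ∀ {m x} → MWalk m x b → HeadAtTarget G m ⊎ InAn G W x → InAn G W x
  start-inAnW _ (inj₂ x∈anW) = x∈anW
  start-inAnW w (inj₁ hm) with start-inAn⊎anc hm w
  ... | inj₁ x∈anC = inAn-⊆ G C⊆anW x∈anC
  ... | inj₂ x≤b = b , b∈W , x≤b

  entering : ∀ {x y} s → EdgeOK G x s y → InAn G W x → HeadAtTarget G s ⊎ InAn G W y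
  entering fwd _ _ = inj₁ tt
  entering bwd y→x x∈anW = inj₂ (inAn-anc G (step y→x here) x∈anW)
  entering bid _ _ = inj₁ tt

  collider-chain : ∀ {m x} (w : MWalk m x b) → Simple w → a ∉ₗ vertices w → x ≢ b →
                   HeadAtTarget G m ⊎ InAn G W x →
                   HeadAtTarget G m × ∃ λ v → BiConnIn G (InAn G W) x v × IntoEdge G b v
  collider-chain [] _ _ x≢b _ = ⊥-elim (x≢b refl)
  collider-chain {m} {x} w@(step s e r rest) (_ , simple) a∉w x≢b entered =
    continue (collider-in r (anW⊆C x∈anW (λ { refl → a∉w (Any.here refl) }) x≢b))
             e rest simple (a∉w ∘ Any.there)
    where
    x∈anW : InAn G W x
    x∈anW = start-inAnW w entered
    continue : ∀ {y} → Collider m s → EdgeOK G x s y →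
               (rest : MWalk s y b) → Simple rest → a ∉ₗ vertices rest →
               HeadAtTarget G m × ∃ λ v → BiConnIn G (InAn G W) x v × IntoEdge G b v
    continue (hm , hs) e [] _ _ = hm , x , here x∈anW , into-source G s hs e
    continue (hm , hs) e rest@(step _ _ _ rest′) simple a∉rest
      with collider-chain rest simple a∉rest (λ { refl → proj₁ simple (end∈vertices rest′) })
                          (entering s e x∈anW)
    ... | ht , v , y~v , bv = hm , v , step x∈anW (both-heads G s ht hs e) y~v , bv

  simple-walk⇒collider-connected : (w : MConnectingWalk a b) → Simple w → a ≢ b →
                                   ColliderConnected G (InAn G W) a b
  simple-walk⇒collider-connected [] _ a≢b = ⊥-elim (a≢b refl)
  simple-walk⇒collider-connected (step s e _ []) _ _ = inj₁ (edge-adjacent G s e)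
  simple-walk⇒collider-connected (step s e _ rest@(step _ _ _ rest′)) (a∉rest , simple) _
    with collider-chain rest simple a∉rest (λ { refl → proj₁ simple (end∈vertices rest′) })
                        (entering s e (a , a∈W , here))
  ... | hs , v , chain , bv = inj₂ (_ , v , into-target G s hs e , chain , bv)

module _ {n : ℕ} (G : ADMG n) where
  open ADMG G

  SelfOrChild : Fin n → Fin n → Set
  SelfOrChild a x = x ≡ a ⊎ dir a x ≡ true

  module _ {P : Pred (Fin n) 0ℓ} where

    into-chain : ∀ {a x y} → SelfOrChild a x → BiConnIn G P x y →
                 (∃ λ v → IntoEdge G a v × BiConnIn G P v y) ⊎ y ≡ a
    into-chain (inj₂ a→x) xy = inj₁ (_ , inj₁ a→x , xy)
    into-chain (inj₁ refl) (here _) = inj₂ refl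
    into-chain (inj₁ refl) (step _ a↔c cy) = inj₁ (_ , inj₂ a↔c , cy)

    join-entries : ∀ {a b x y} → SelfOrChild a x → BiConnIn G P x y → SelfOrChild b y → a ≢ b →
                   ColliderConnected G P a b
    join-entries ax xy by a≢b with into-chain ax xy
    ... | inj₂ refl with by
    ...   | inj₁ refl = ⊥-elim (a≢b refl)
    ...   | inj₂ b→a = inj₁ (inj₂ (inj₁ b→a))
    join-entries ax xy by a≢b | inj₁ (v , av , vy) with into-chain by (biConn-sym G vy)
    ...   | inj₂ refl = inj₁ (intoEdge⇒adjacent G av)
    ...   | inj₁ (w , bw , wv) = inj₂ (v , w , av , biConn-sym G wv , bw)

  module _ {H A : Subset n} (head : Head G H) (A⊆tail : ∀ v → v ∈ A → InTail G H v) where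

    district-entry : ∀ {a} → a ∈ H ∪ A → ∃ λ x → InDis G H x × SelfOrChild a x
    district-entry {a} a∈ with x∈p∪q⁻ H A a∈
    ... | inj₁ a∈H = a , (a , a∈H , here (a , a∈H , here)) , inj₁ refl
    ... | inj₂ a∈A with A⊆tail a a∈A
    ...   | inj₁ (a∈dis , _) = a , a∈dis , inj₁ refl
    ...   | inj₂ (x , x∈dis , a→x) = x , x∈dis , inj₂ a→x

    district-connected : ∀ {x y} → InDis G H x → InDis G H y → BiConnIn G (InAn G H) x y
    district-connected (h , h∈H , hx) (h′ , h′∈H , h′y) =
      biConn-trans G (biConn-sym G hx) (biConn-trans G (proj₂ head h h′ h∈H h′∈H) h′y)

    head-collider-connected : ∀ {a b} → a ∈ H ∪ A → b ∈ H ∪ A → a ≢ b →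
                              ColliderConnected G (InAn G H) a b
    head-collider-connected a∈ b∈ a≢b with district-entry a∈ | district-entry b∈
    ... | x , x∈dis , ax | y , y∈dis , by = join-entries ax (district-connected x∈dis y∈dis) by a≢b

  module _ (W : Subset n) where

    InBarren : Pred (Fin n) 0ℓ
    InBarren x = x ∈ W × (∀ y → y ∈ W → Anc G x y → x ≡ y)

    inBarren? : Decidable InBarren
    inBarren? x = x ∈? W ×-dec all? (λ y → y ∈? W →-dec (anc? G x y →-dec x ≟ y))

    barren : Subset n
    barren = subset inBarren?

    ∈-barren⁻ : ∀ {x} → x ∈ barren → InBarren x
    ∈-barren⁻ = ∈-subset⁻ inBarren?

    descendant? : ∀ x → Decidable (λ y → y ∈ W × Anc G x y)
    descendant? x y = y ∈? W ×-dec anc? G x y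

    descendants-shrink : ∀ {x y} → x ∈ W → Anc G x y → x ≢ y →
                         subset (descendant? y) ⊂ subset (descendant? x)
    descendants-shrink {x} {y} x∈W x≤y x≢y = down , x , ∈-subset⁺ (descendant? x) (x∈W , here) , x∉
      where
      down : ∀ {z} → z ∈ subset (descendant? y) → z ∈ subset (descendant? x)
      down z∈ = let z∈W , y≤z = ∈-subset⁻ (descendant? y) z∈
                in ∈-subset⁺ (descendant? x) (z∈W , anc-trans G x≤y y≤z)
      x∉ : x ∉ subset (descendant? y)
      x∉ x∈ = x≢y (anc-antisym G x≤y (proj₂ (∈-subset⁻ (descendant? y) x∈)))

    barren-above : ∀ {x} → x ∈ W → ∃ λ h → InBarren h × Anc G x h
    barren-above {x} = go x (⊂-wellFounded (subset (descendant? x)))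
      where
      go : ∀ x → Acc _⊂_ (subset (descendant? x)) → x ∈ W → ∃ λ h → InBarren h × Anc G x h
      go x (acc rec) x∈W with any? (λ y → descendant? x y ×-dec ¬? (x ≟ y))
      ... | yes (y , (y∈W , x≤y) , x≢y) =
            let h , h-barren , y≤h = go y (rec (descendants-shrink x∈W x≤y x≢y)) y∈W
            in h , h-barren , anc-trans G x≤y y≤h
      ... | no none =
            let maximal : ∀ y → y ∈ W → Anc G x y → x ≡ y
                maximal y y∈W x≤y = decidable-stable (x ≟ y) λ x≢y → none (y , (y∈W , x≤y) , x≢y)
            in x , (x∈W , maximal) , here

    barren⇒inAn : ∀ {h} → h ∈ barren → InAn G barren h
    barren⇒inAn h∈ = _ , h∈ , here

    anW⇒anBarren : ∀ {x} → InAn G W x → InAn G barren x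
    anW⇒anBarren (w , w∈W , x≤w) =
      let h , h-barren , w≤h = barren-above w∈W in h , ∈-subset⁺ inBarren? h-barren , anc-trans G x≤w w≤h

    barren-no-child : ∀ {h v} → h ∈ barren → dir h v ≡ true → ¬ InAn G barren v
    barren-no-child {h} {v} h∈ h→v (h′ , h′∈ , v≤h′) =
      acyclic h v h→v (subst (Anc G v) (sym h≡h′) v≤h′)
      where
      h≡h′ : h ≡ h′
      h≡h′ = proj₂ (∈-barren⁻ h∈) h′ (proj₁ (∈-barren⁻ h′∈)) (step h→v v≤h′)

    barren-into : ∀ {h v} → h ∈ barren → IntoEdge G h v → InAn G W v → bi h v ≡ true
    barren-into h∈ (inj₁ h→v) v∈anW = ⊥-elim (barren-no-child h∈ h→v (anW⇒anBarren v∈anW))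
    barren-into _ (inj₂ h↔v) _ = h↔v

    district-via : ∀ {h v w} → h ∈ barren → IntoEdge G h w → BiConnIn G (InAn G W) v w →
                   BiConnIn G (InAn G barren) h v
    district-via h∈ hw vw =
      step (barren⇒inAn h∈) (barren-into h∈ hw (biConn-end G vw))
           (biConn-sym G (biConn-mono G anW⇒anBarren vw))

    nonbarren? : Decidable (λ x → x ∈ W × ¬ InBarren x)
    nonbarren? x = x ∈? W ×-dec ¬? (inBarren? x)

    barren-partition : W ≡ barren ∪ subset nonbarren?
    barren-partition = ⊆-antisym split merge
      where
      split : ∀ {x} → x ∈ W → x ∈ barren ∪ subset nonbarren?
      split {x} x∈W with inBarren? x
      ... | yes x-barren = x∈p∪q⁺ (inj₁ (∈-subset⁺ inBarren? x-barren))
      ... | no ¬x-barren = x∈p∪q⁺ (inj₂ (∈-subset⁺ nonbarren? (x∈W , ¬x-barren)))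
      merge : ∀ {x} → x ∈ barren ∪ subset nonbarren? → x ∈ W
      merge x∈ =
        [ proj₁ ∘ ∈-barren⁻ , proj₁ ∘ ∈-subset⁻ nonbarren? ] (x∈p∪q⁻ barren (subset nonbarren?) x∈)

    module _ (linked : ∀ {a b} → a ∈ W → b ∈ W → a ≢ b → ColliderConnected G (InAn G W) a b) where

      barren-connected : ∀ {h h′} → h ∈ barren → h′ ∈ barren → h ≢ h′ → BiConnIn G (InAn G barren) h h′
      barren-connected {h} {h′} h∈ h′∈ h≢h′ =
        from-link (linked (proj₁ (∈-barren⁻ h∈)) (proj₁ (∈-barren⁻ h′∈)) h≢h′)
        where
        from-link : ColliderConnected G (InAn G W) h h′ → BiConnIn G (InAn G barren) h h′
        from-link (inj₁ (inj₁ h→h′)) = ⊥-elim (barren-no-child h∈ h→h′ (barren⇒inAn h′∈))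
        from-link (inj₁ (inj₂ (inj₁ h′→h))) = ⊥-elim (barren-no-child h′∈ h′→h (barren⇒inAn h∈))
        from-link (inj₁ (inj₂ (inj₂ h↔h′))) = step (barren⇒inAn h∈) h↔h′ (here (barren⇒inAn h′∈))
        from-link (inj₂ (v , _ , hv , vw , h′w)) =
          step (barren⇒inAn h∈) (barren-into h∈ hv (biConn-start G vw))
               (biConn-sym G (district-via h′∈ h′w vw))

      barren-head : Head G barren
      barren-head = (λ h w h∈ w∈ → proj₂ (∈-barren⁻ h∈) w (proj₁ (∈-barren⁻ w∈))) , connected
        where
        connected : ∀ h h′ → h ∈ barren → h′ ∈ barren → BiConnIn G (InAn G barren) h h′
        connected h h′ h∈ h′∈ = decide (h ≟ h′)
          where
          decide : Dec (h ≡ h′) → BiConnIn G (InAn G barren) h h′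
          decide (yes refl) = here (barren⇒inAn h∈)
          decide (no h≢h′) = barren-connected h∈ h′∈ h≢h′

      below-barren⇒tail : ∀ {x h} → x ∈ W → x ∉ barren → h ∈ barren → Anc G x h → InTail G barren x
      below-barren⇒tail {x} {h} x∈W x∉H h∈ x≤h =
        from-link (linked x∈W (proj₁ (∈-barren⁻ h∈)) λ { refl → x∉H h∈ })
        where
        x∈anH : InAn G barren x
        x∈anH = h , h∈ , x≤h
        from-link : ColliderConnected G (InAn G W) x h → InTail G barren x
        from-link (inj₁ (inj₁ x→h)) = inj₂ (h , (h , h∈ , here (barren⇒inAn h∈)) , x→h)
        from-link (inj₁ (inj₂ (inj₁ h→x))) = ⊥-elim (barren-no-child h∈ h→x x∈anH)
        from-link (inj₁ (inj₂ (inj₂ x↔h))) =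
          inj₁ ((h , h∈ , biConn-snoc G (here (barren⇒inAn h∈)) (bi-flip G x↔h) x∈anH) , x∉H)
        from-link (inj₂ (v , _ , inj₁ x→v , vw , hw)) = inj₂ (v , (h , h∈ , district-via h∈ hw vw) , x→v)
        from-link (inj₂ (v , _ , inj₂ x↔v , vw , hw)) =
          inj₁ ((h , h∈ , biConn-snoc G (district-via h∈ hw vw) (bi-flip G x↔v) x∈anH) , x∉H)

      nonbarren⊆tail : ∀ x → x ∈ subset nonbarren? → InTail G barren x
      nonbarren⊆tail x x∈ =
        let x∈W , ¬x-barren = ∈-subset⁻ nonbarren? x∈
            h , h-barren , x≤h = barren-above x∈W
        in below-barren⇒tail x∈W (¬x-barren ∘ ∈-barren⁻) (∈-subset⁺ inBarren? h-barren) x≤h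

      pairwise-connected⇒InS : InS G W
      pairwise-connected⇒InS = barren , subset nonbarren? , barren-head , nonbarren⊆tail , barren-partition

module _ {n : ℕ} (G : ADMG n) {W C : Subset n} {a b : Fin n} where

  InS⇒m-connected : InS G W → a ∈ W → b ∈ W → a ≢ b → a ∉ C →
                    (∀ v → v ∈ W → v ∈ C ⊎ v ≡ a ⊎ v ≡ b) →
                    Σ (Path G a b) (MConnecting G C)
  InS⇒m-connected (H , A , head , A⊆tail , refl) a∈W b∈W a≢b a∉C cover =
    walk⇒m-connecting-path
      (collider-connected⇒walk cover′ (head-collider-connected G head A⊆tail a∈W b∈W a≢b))
    where
    open MWalks G C
    open Unblocking G C a∉C
    cover′ : ∀ {v} → InAn G H v → InAn G C v ⊎ Anc G v a ⊎ Anc G v b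
    cover′ (h , h∈H , v≤h) with cover h (x∈p∪q⁺ (inj₁ h∈H))
    ... | inj₁ h∈C = inj₁ (h , h∈C , v≤h)
    ... | inj₂ (inj₁ refl) = inj₂ (inj₁ v≤h)
    ... | inj₂ (inj₂ refl) = inj₂ (inj₂ v≤h)

module _ {n : ℕ} (G : ADMG n) (W : Subset n) where

  SeparatedPair : Set
  SeparatedPair = ∃ λ a → ∃ λ b → ∃ λ C →
    a ∈ W × b ∈ W × a ≢ b × a ∉ C × b ∉ C ×
    (∀ v → v ∈ W → v ∈ C ⊎ v ≡ a ⊎ v ≡ b) × MSeparated G a b C

  Unlinked : Fin n → Fin n → Set
  Unlinked a b = a ∈ W × b ∈ W × a ≢ b × ¬ ColliderConnected G (InAn G W) a b

  unlinked? : ∀ a b → Dec (Unlinked a b)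
  unlinked? a b = a ∈? W ×-dec b ∈? W ×-dec ¬? (a ≟ b) ×-dec ¬? (colliderConnected? G (inAn? G W) a b)

  unlinked-pair : ¬ InS G W → ∃₂ Unlinked
  unlinked-pair ¬S = search (any? (λ a → any? (unlinked? a)))
    where
    linked : ¬ ∃₂ Unlinked → ∀ {a b} → a ∈ W → b ∈ W → a ≢ b → ColliderConnected G (InAn G W) a b
    linked none {a} {b} a∈W b∈W a≢b = connect (colliderConnected? G (inAn? G W) a b)
      where
      connect : Dec (ColliderConnected G (InAn G W) a b) → ColliderConnected G (InAn G W) a b
      connect (yes c) = c
      connect (no ¬c) = ⊥-elim (none (a , b , a∈W , b∈W , a≢b , ¬c))
    search : Dec (∃₂ Unlinked) → ∃₂ Unlinked
    search (yes u) = u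
    search (no none) = ⊥-elim (¬S (pairwise-connected⇒InS G W (linked none)))

  unlinked⇒separated : ∀ {a b} → Unlinked a b → ∃ λ C → a ∉ C × b ∉ C ×
                         (∀ v → v ∈ W → v ∈ C ⊎ v ≡ a ⊎ v ≡ b) × MSeparated G a b C
  unlinked⇒separated {a} {b} (a∈W , b∈W , a≢b , ¬linked) = C , a∉C , b∉C , cover , separated
    where
    inC? : ∀ v → Dec (InAn G W v × v ≢ a × v ≢ b)
    inC? v = inAn? G W v ×-dec ¬? (v ≟ a) ×-dec ¬? (v ≟ b)
    C : Subset n
    C = subset inC?
    a∉C : a ∉ C
    a∉C a∈C = proj₁ (proj₂ (∈-subset⁻ inC? a∈C)) refl
    b∉C : b ∉ C
    b∉C b∈C = proj₂ (proj₂ (∈-subset⁻ inC? b∈C)) refl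
    anW⊆C : ∀ {v} → InAn G W v → v ≢ a → v ≢ b → v ∈ C
    anW⊆C v∈anW v≢a v≢b = ∈-subset⁺ inC? (v∈anW , v≢a , v≢b)
    cover : ∀ v → v ∈ W → v ∈ C ⊎ v ≡ a ⊎ v ≡ b
    cover v v∈W with v ≟ a | v ≟ b
    ... | yes v≡a | _ = inj₂ (inj₁ v≡a)
    ... | no _ | yes v≡b = inj₂ (inj₂ v≡b)
    ... | no v≢a | no v≢b = inj₁ (anW⊆C (v , v∈W , here) v≢a v≢b)
    open MWalks G C
    open Separation G W C a∈W b∈W (proj₁ ∘ ∈-subset⁻ inC?) anW⊆C
    separated : MSeparated G a b C
    separated m-connected = let w , simple = m-connecting-path⇒walk a∉C m-connected
                            in ¬linked (simple-walk⇒collider-connected w simple a≢b)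

  ¬InS⇒separated-pair : ¬ InS G W → SeparatedPair
  ¬InS⇒separated-pair ¬S =
    let a , b , unlinked = unlinked-pair ¬S
        a∈W , b∈W , a≢b , _ = unlinked
        C , a∉C , b∉C , cover , separated = unlinked⇒separated unlinked
    in a , b , C , a∈W , b∈W , a≢b , a∉C , b∉C , cover , separated

  separated-pair⇒¬InS : SeparatedPair → ¬ InS G W
  separated-pair⇒¬InS (a , b , C , a∈W , b∈W , a≢b , a∉C , _ , cover , separated) S =
    separated (InS⇒m-connected G S a∈W b∈W a≢b a∉C cover)

proposition3p3 : ∀ (n : ℕ) (G : ADMG n) → IsMAG G → (W : Subset n) →
    (¬ InS G W) ⇔
      (∃ λ (a : Fin n) → ∃ λ (b : Fin n) → ∃ λ (C : Subset n) →
         a ∈ W × b ∈ W × a ≢ b × a ∉ C × b ∉ C ×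
         (∀ v → v ∈ W → v ∈ C ⊎ v ≡ a ⊎ v ≡ b) ×
         MSeparated G a b C)
proposition3p3 n G _ W = mk⇔ (¬InS⇒separated-pair G W) (separated-pair⇒¬InS G W)
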